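{- Let $d \geq 2$ and $n \geq 1$ be integers, and let $\delta := (n+2)^{ -1}$. Then the right $d$-simplex \[ S^{n+\delta} := \{ x \in \mathbb{R}^d : n + \delta \geq x_1 \geq x_2 \geq \cdots \geq x_d \geq 0 \}, \] whose shortest side has length $n+\delta$, can be covered by \[ (n+1)^d + (n-1)^d - n^d \] unit right $d$-simplices; that is, there exist this many unit right $d$-simplices whose union contains $S^{n+\delta}$.
   Context: Let $e^1,\dots,e^d$ denote the unit coordinate vectors in $\mathbb{R}^d$ and $e := \sum_j e^j$. A unit right $d$-simplex is the convex hull of $0, e^1, e^1+e^2, \dots, e^1+e^2+\cdots+e^d$, or any image of this set under a permutation of the coordinates followed by a translation; equivalently, for some $v \in \mathbb{R}^d$ and some permutation $\pi$ of $\{1,\dots,d\}$, it is the set $\{x \in \mathbb{R}^d : 1 \geq (x-v)_{\pi(1)} \geq (x-v)_{\pi(2)} \geq \cdots \geq (x-v)_{\pi(d)} \geq 0\}$. A right $d$-simplex is the image of a unit right $d$-simplex under a dilation by a factor $\alpha>0$; its shortest side has length $\alpha$.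
   Formalization: The points of $S^{n+\delta}$ to be covered and the translations of the unit right $d$-simplices are taken in ℚ^d rather than $\mathbb{R}^d$. -}

module Defs where

open import Data.Nat as ℕ using (ℕ; suc)
open import Data.Fin using (Fin; toℕ)
open import Data.Fin.Permutation using (Permutation′; _⟨$⟩ʳ_)
open import Data.Integer using (+_)
open import Data.Rational using (ℚ; _≤_; _+_; _-_; 0ℚ; 1ℚ; _/_)
open import Data.Product using (_×_; Σ; ∃)
open import Relation.Binary.PropositionalEquality using (_≡_)

Point : ℕ → Set
Point d = Fin d → ℚ

DescChain : {d : ℕ} → ℚ → Point d → Set
DescChain {d} a y =
  (∀ (i : Fin d) → toℕ i ≡ 0 → y i ≤ a) ×
  (∀ (i j : Fin d) → toℕ j ≡ suc (toℕ i) → y j ≤ y i) ×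
  (∀ (i : Fin d) → suc (toℕ i) ≡ d → 0ℚ ≤ y i)

InUnitRightSimplex : {d : ℕ} → Point d → Permutation′ d → Point d → Set
InUnitRightSimplex v π x = DescChain 1ℚ (λ i → x (π ⟨$⟩ʳ i) - v (π ⟨$⟩ʳ i))

InS : {d : ℕ} → ℚ → Point d → Set
InS a x = DescChain a x

δ : ℕ → ℚ
δ n = + 1 / suc (suc n)

CoveredBy : (d N : ℕ) → ℚ → Set
CoveredBy d N a =
  Σ (Fin N → Point d) λ v → Σ (Fin N → Permutation′ d) λ π →
    ∀ (x : Point d) → InS a x → ∃ λ (k : Fin N) → InUnitRightSimplex (v k) (π k) x

module Submission where

-- Let a = n + ε with ε = δ, so that (n + 1) ε ≤ 1, and let t be the last coordinate of x ∈ S^a.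
-- If t > 1 + ε, then x − (1 + ε) e lies in S^(n−1), which is covered by the (n − 1)^d Kuhn
-- simplices g + Δ_π with g ∈ {0, …, n − 2}^d.
-- Otherwise write x_j = g_j (1 − ε) + r_j with g_j ≤ n least such that r_j ≤ 1 (it exists as
-- (n + 1) ε ≤ 1), except g = 0 and r = t at the last coordinate; then r_j > ε whenever g_j > 0.
-- If some other residual is at least t, all residuals lie in [0, 1]; otherwise t is the largest
-- residual and all residuals minus ε lie in [0, 1]. So x lies in g (1 − ε) + c e + Δ_π, where π
-- sorts the residuals and c ∈ {0, ε} is decided by whether π ranks the last coordinate first.
-- As g decreases and the residuals decrease on each level set of g, (g, π) is recovered from the
-- levels g ∘ π in rank order by a stable sort; these take values in {0, …, n} and hit 0, which
-- leaves (n + 1)^d − n^d simplices.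

open import Defs
open import Data.Nat as ℕ using (ℕ; zero; suc; z≤n; s≤s; _^_)
import Data.Nat.Properties as ℕ
open import Data.Fin as F using (Fin; zero; suc; toℕ; punchIn; inject₁; _↑ˡ_; _↑ʳ_; remQuot; combine; finToFun; funToFin)
import Data.Fin.Properties as F
open import Data.Fin.Induction using (<-weakInduction; <-weakInduction-startingFrom)
open import Data.Fin.Permutation using (Permutation′; _⟨$⟩ʳ_; _⟨$⟩ˡ_; inverseˡ; inverseʳ; flip; insert; insert-punchIn)
import Data.Fin.Permutation as Perm
open import Data.Integer using (+_)
open import Data.Rational as ℚ using (ℚ; 0ℚ; 1ℚ; _+_; _-_; _*_; -_; _/_)
import Data.Rational.Properties as ℚ
import Data.Integer as ℤ using (_+_)
import Data.Integer.Properties as ℤ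
import Data.Nat.Coprimality as C
open import Data.Rational.Solver using (module +-*-Solver)
open import Data.Vec.Functional using (_∷_; _++_)
open import Data.Vec.Functional.Properties using (lookup-++ˡ; lookup-++ʳ)
open import Data.Product using (∃; _×_; _,_; proj₁; proj₂; uncurry)
open import Data.Sum using (_⊎_; inj₁; inj₂)
open import Function using (_∘_)
open import Relation.Binary.Bundles using (DecTotalOrder)
open import Relation.Binary.Definitions using (tri<; tri≈; tri>)
open import Relation.Binary.PropositionalEquality
  using (_≡_; _≢_; refl; sym; trans; cong; cong₂; cong-app; subst; subst₂; module ≡-Reasoning)
open import Algebra.Properties.CommutativeSemigroup ℕ.+-commutativeSemigroup using (xy∙z≈xz∙y)
open import Relation.Nullary using (¬_; Dec; yes; no; contradiction; ¬?; _×-dec_)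

punchIn-mono-< : ∀ {n} (i : Fin (suc n)) {j k : Fin n} → j F.< k → punchIn i j F.< punchIn i k
punchIn-mono-< i {j} {k} j<k =
  F.≤∧≢⇒< (F.punchIn-mono-≤ i j k (ℕ.<⇒≤ j<k)) (F.<⇒≢ j<k ∘ F.punchIn-injective i j k)

strictlyIncreasing⇒inflationary : ∀ {n} (f : Fin (suc n) → Fin (suc n)) →
  (∀ {i j} → i F.< j → f i F.< f j) → ∀ i → i F.≤ f i
strictlyIncreasing⇒inflationary f f-inc = <-weakInduction (λ i → i F.≤ f i) z≤n step
  where
  step : ∀ i → inject₁ i F.≤ f (inject₁ i) → suc i F.≤ f (suc i)
  step i ih rewrite F.toℕ-inject₁ i = ℕ.<-≤-trans (s≤s ih) (f-inc (F.≤̄⇒inject₁< ℕ.≤-refl))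

module StableSort {a ℓ₁ ℓ₂} (O : DecTotalOrder a ℓ₁ ℓ₂) where

  open DecTotalOrder O using (_≤_; _≤?_; total) renaming (Carrier to A; refl to ≤-refl; trans to ≤-trans)

  private variable
    d : ℕ

  -- r comes before r′ when u is sorted in decreasing order, ties broken by increasing index
  Precedes : (Fin d → A) → Fin d → Fin d → Set ℓ₂
  Precedes u r r′ = u r′ ≤ u r × (u r ≤ u r′ → r F.< r′)

  SortedBy : (Fin d → A) → Permutation′ d → Set ℓ₂
  SortedBy u τ = ∀ {i j} → i F.< j → Precedes u (τ ⟨$⟩ʳ i) (τ ⟨$⟩ʳ j)

  Precedes-irrefl : ∀ u {r} → ¬ Precedes {d} u r r
  Precedes-irrefl _ (_ , r<r) = F.<-irrefl refl (r<r ≤-refl)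

  Precedes-asym : ∀ u {r r′} → Precedes {d} u r r′ → ¬ Precedes u r′ r
  Precedes-asym _ (ur′≤ur , r<r′) (ur≤ur′ , r′<r) = F.<-asym (r<r′ ur≤ur′) (r′<r ur′≤ur)

  Precedes-map : ∀ u {m} (f : Fin m → Fin d) → (∀ {i j} → i F.< j → f i F.< f j) →
                 ∀ {r r′} → Precedes (u ∘ f) r r′ → Precedes u (f r) (f r′)
  Precedes-map _ f f-inc (ur′≤ur , r<r′) = ur′≤ur , f-inc ∘ r<r′

  Leader : (Fin (suc d) → A) → Fin (suc d) → Set ℓ₂
  Leader u m = ∀ j → u j ≤ u m × (j F.< m → ¬ u m ≤ u j)

  leader : (u : Fin (suc d) → A) → ∃ (Leader u)
  leader {zero} u = zero , λ { zero → ≤-refl , λ () }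
  leader {suc d} u with leader (u ∘ suc)
  ... | m , m-leads with u (suc m) ≤? u zero
  ...   | yes um≤u0 = zero , λ { zero → ≤-refl , λ ()
                               ; (suc j) → ≤-trans (proj₁ (m-leads j)) um≤u0 , λ () }
  ...   | no um≰u0 = suc m , λ { zero → u0≤um , λ _ → um≰u0
                               ; (suc j) → proj₁ (m-leads j) , proj₂ (m-leads j) ∘ ℕ.s≤s⁻¹ }
    where
    u0≤um : u zero ≤ u (suc m)
    u0≤um with total (u zero) (u (suc m))
    ... | inj₁ u0≤um = u0≤um
    ... | inj₂ um≤u0 = contradiction um≤u0 um≰u0

  leader-precedes : ∀ u {m j} → Leader {d} u m → j ≢ m → Precedes u m j
  leader-precedes u {m} {j} m-leads j≢m = proj₁ (m-leads j) , m<j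
    where
    m<j : _ → m F.< j
    m<j um≤uj with F.<-cmp m j
    ... | tri< m<j _ _ = m<j
    ... | tri≈ _ m≡j _ = contradiction (sym m≡j) j≢m
    ... | tri> _ _ j<m = contradiction um≤uj (proj₂ (m-leads j) j<m)

  sortBy : (Fin d → A) → Permutation′ d
  sortBy {zero} u = Perm.id
  sortBy {suc d} u = insert zero m (sortBy (u ∘ punchIn m))
    where m = proj₁ (leader u)

  sortBy-sorted : (u : Fin d → A) → SortedBy u (sortBy u)
  sortBy-sorted {suc d} u {zero} {suc k} _ =
    subst (Precedes u m) (sym (insert-punchIn zero m σ k))
          (leader-precedes u (proj₂ (leader u)) (F.punchInᵢ≢i m (σ ⟨$⟩ʳ k)))
    where
    m = proj₁ (leader u)
    σ = sortBy (u ∘ punchIn m)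
  sortBy-sorted {suc d} u {suc i} {suc j} i<j =
    subst₂ (Precedes u) (sym (insert-punchIn zero m σ i)) (sym (insert-punchIn zero m σ j))
           (Precedes-map u (punchIn m) (punchIn-mono-< m) (sortBy-sorted (u ∘ punchIn m) (ℕ.s≤s⁻¹ i<j)))
    where
    m = proj₁ (leader u)
    σ = sortBy (u ∘ punchIn m)

  sorted-rank : ∀ u τ → SortedBy {d} u τ → ∀ {i j} → Precedes u (τ ⟨$⟩ʳ i) (τ ⟨$⟩ʳ j) → i F.< j
  sorted-rank u τ τ-sorted {i} {j} p with F.<-cmp i j
  ... | tri< i<j _ _ = i<j
  ... | tri≈ _ refl _ = contradiction p (Precedes-irrefl u)
  ... | tri> _ _ j<i = contradiction (τ-sorted j<i) (Precedes-asym u p)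

  sorted-transition-increasing : ∀ u τ τ′ → SortedBy {d} u τ → SortedBy u τ′ →
    ∀ {i j} → i F.< j → τ ⟨$⟩ˡ (τ′ ⟨$⟩ʳ i) F.< τ ⟨$⟩ˡ (τ′ ⟨$⟩ʳ j)
  sorted-transition-increasing u τ τ′ τ-sorted τ′-sorted i<j =
    sorted-rank u τ τ-sorted (subst₂ (Precedes u) (sym (inverseʳ τ)) (sym (inverseʳ τ)) (τ′-sorted i<j))

  sorted-head : ∀ u τ → SortedBy {suc d} u τ → ∀ {m} → (∀ j → j ≢ m → Precedes u m j) → τ ⟨$⟩ʳ zero ≡ m
  sorted-head u τ τ-sorted {m} m-first with τ ⟨$⟩ʳ zero F.≟ m
  ... | yes τ0≡m = τ0≡m
  ... | no  τ0≢m = contradiction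
    (sorted-rank u τ τ-sorted (subst (λ k → Precedes u k (τ ⟨$⟩ʳ zero)) (sym (inverseʳ τ)) (m-first _ τ0≢m)))
    λ ()

  sorted-head-not : ∀ u τ → SortedBy {suc d} u τ → ∀ {j m} → Precedes u j m → τ ⟨$⟩ʳ zero ≢ m
  sorted-head-not u τ τ-sorted {j} j≺m τ0≡m = contradiction
    (sorted-rank u τ τ-sorted (subst₂ (Precedes u) (sym (inverseʳ τ)) (sym τ0≡m) j≺m))
    λ ()

  -- both transition maps between two sortings are increasing, hence the identity
  sorted-unique : ∀ u τ τ′ → SortedBy {d} u τ → SortedBy u τ′ → ∀ i → τ ⟨$⟩ʳ i ≡ τ′ ⟨$⟩ʳ i
  sorted-unique {zero} _ _ _ _ _ ()
  sorted-unique {suc d} u τ τ′ τ-sorted τ′-sorted i = begin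
    τ ⟨$⟩ʳ i         ≡⟨ cong (τ ⟨$⟩ʳ_) (sym ρi≡i) ⟩
    τ ⟨$⟩ʳ ρ i       ≡⟨ inverseʳ τ ⟩
    τ′ ⟨$⟩ʳ i        ∎
    where
    open ≡-Reasoning
    ρ ρ′ : Fin (suc d) → Fin (suc d)
    ρ j = τ ⟨$⟩ˡ (τ′ ⟨$⟩ʳ j)
    ρ′ j = τ′ ⟨$⟩ˡ (τ ⟨$⟩ʳ j)
    ρ′∘ρ : ρ′ (ρ i) ≡ i
    ρ′∘ρ = trans (cong (τ′ ⟨$⟩ˡ_) (inverseʳ τ)) (inverseˡ τ′)
    ρi≡i : ρ i ≡ i
    ρi≡i = F.≤-antisym
      (subst (ρ i F.≤_) ρ′∘ρ
        (strictlyIncreasing⇒inflationary ρ′ (sorted-transition-increasing u τ′ τ τ′-sorted τ-sorted) (ρ i)))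
      (strictlyIncreasing⇒inflationary ρ (sorted-transition-increasing u τ τ′ τ-sorted τ′-sorted) i)

fromℕ : ℕ → ℚ
fromℕ k = + k / 1

fromℕ-suc : ∀ k → fromℕ (suc k) ≡ 1ℚ + fromℕ k
fromℕ-suc k rewrite ℚ.normalize-coprime (C.sym (C.1-coprimeTo k)) =
  cong (λ i → i / 1) (cong (ℤ._+_ (+ 1)) (sym (ℤ.*-identityʳ (+ k))))

δ-positive : ∀ n → 0ℚ ℚ.< δ n
δ-positive n rewrite ℚ.normalize-coprime (C.1-coprimeTo (suc (suc n))) = ℚ.positive⁻¹ _

δ-inverse : ∀ n → fromℕ (suc (suc n)) * δ n ≡ 1ℚ
δ-inverse n rewrite ℚ.normalize-coprime (C.sym (C.1-coprimeTo (suc (suc n))))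
                  | ℚ.normalize-coprime (C.1-coprimeTo (suc (suc n))) =
  ℚ.*-inverseʳ (ℚ.mkℚ (+ suc (suc n)) 0 (C.sym (C.1-coprimeTo (suc (suc n)))))

open +-*-Solver

sub-monoˡ-≤ : ∀ r {p q} → p ℚ.≤ q → p - r ℚ.≤ q - r
sub-monoˡ-≤ r = ℚ.+-monoˡ-≤ (- r)

sub-monoˡ-< : ∀ r {p q} → p ℚ.< q → p - r ℚ.< q - r
sub-monoˡ-< r = ℚ.+-monoˡ-< (- r)

p≤q⇒0≤q-p : ∀ {p q} → p ℚ.≤ q → 0ℚ ℚ.≤ q - p
p≤q⇒0≤q-p {p} {q} p≤q = subst (ℚ._≤ q - p) (ℚ.+-inverseʳ p) (sub-monoˡ-≤ p p≤q)

<⇒≱ : ∀ {p q} → p ℚ.< q → ¬ q ℚ.≤ p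
<⇒≱ p<q q≤p = ℚ.<-irrefl refl (ℚ.<-≤-trans p<q q≤p)

0≤r⇒p-r≤p : ∀ p {r} → 0ℚ ℚ.≤ r → p - r ℚ.≤ p
0≤r⇒p-r≤p p 0≤r = subst (p - _ ℚ.≤_) (ℚ.+-identityʳ p) (ℚ.+-monoʳ-≤ p (ℚ.neg-antimono-≤ 0≤r))

[n+1]δ≤1 : ∀ n → fromℕ (suc n) * δ n ℚ.≤ 1ℚ
[n+1]δ≤1 n = subst (ℚ._≤ 1ℚ) (sym [n+1]δ≡1-δ) (0≤r⇒p-r≤p 1ℚ (ℚ.<⇒≤ (δ-positive n)))
  where
  open ≡-Reasoning
  [n+1]δ≡1-δ : fromℕ (suc n) * δ n ≡ 1ℚ - δ n
  [n+1]δ≡1-δ = begin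
    fromℕ (suc n) * δ n
      ≡⟨ solve 2 (λ m e → m :* e := (con 1ℚ :+ m) :* e :- e) refl (fromℕ (suc n)) (δ n) ⟩
    (1ℚ + fromℕ (suc n)) * δ n - δ n
      ≡⟨ cong (λ m → m * δ n - δ n) (sym (fromℕ-suc (suc n))) ⟩
    fromℕ (suc (suc n)) * δ n - δ n
      ≡⟨ cong (_- δ n) (δ-inverse n) ⟩
    1ℚ - δ n
      ∎

module _ (c : ℚ) where

  level : ℕ → ℚ → ℕ
  level zero    y = 0
  level (suc b) y with y ℚ.≤? 1ℚ
  ... | yes _ = 0
  ... | no  _ = suc (level b (y - c))

  level-≤ : ∀ b y → level b y ℕ.≤ b
  level-≤ zero    y = z≤n
  level-≤ (suc b) y with y ℚ.≤? 1ℚ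
  ... | yes _ = z≤n
  ... | no  _ = s≤s (level-≤ b (y - c))

  level-mono : ∀ b {y y′} → y ℚ.≤ y′ → level b y ℕ.≤ level b y′
  level-mono zero    y≤y′ = z≤n
  level-mono (suc b) {y} {y′} y≤y′ with y ℚ.≤? 1ℚ | y′ ℚ.≤? 1ℚ
  ... | yes _   | _        = z≤n
  ... | no  y≰1 | yes y′≤1 = contradiction (ℚ.≤-trans y≤y′ y′≤1) y≰1
  ... | no  _   | no  _    = s≤s (level-mono b (sub-monoˡ-≤ c y≤y′))

  residual-zero : ∀ y → y - fromℕ 0 * c ≡ y
  residual-zero = solve 1 (λ y → y :- con 0ℚ :* con c := y) refl

  residual-suc : ∀ y k → (y - c) - fromℕ k * c ≡ y - fromℕ (suc k) * c
  residual-suc y k rewrite fromℕ-suc k =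
    solve 3 (λ y m c → (y :- c) :- m :* c := y :- (con 1ℚ :+ m) :* c) refl y (fromℕ k) c

  level-reaches : ∀ b y → y - fromℕ b * c ℚ.≤ 1ℚ → y - fromℕ (level b y) * c ℚ.≤ 1ℚ
  level-reaches zero    y y≤1 = y≤1
  level-reaches (suc b) y y-bc≤1 with y ℚ.≤? 1ℚ
  ... | yes y≤1 = subst (ℚ._≤ 1ℚ) (sym (residual-zero y)) y≤1
  ... | no  _   = subst (ℚ._≤ 1ℚ) (residual-suc y (level b (y - c)))
                    (level-reaches b (y - c) (subst (ℚ._≤ 1ℚ) (sym (residual-suc y b)) y-bc≤1))

  level-minimal : ∀ b y → level b y ≡ 0 ⊎ 1ℚ - c ℚ.< y - fromℕ (level b y) * c
  level-minimal zero    y = inj₁ refl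
  level-minimal (suc b) y with y ℚ.≤? 1ℚ
  ... | yes _ = inj₁ refl
  ... | no  y≰1 with level-minimal b (y - c)
  ...   | inj₂ 1-c<r = inj₂ (subst (1ℚ - c ℚ.<_) (residual-suc y (level b (y - c))) 1-c<r)
  ...   | inj₁ l≡0 = inj₂ (subst (1ℚ - c ℚ.<_) (residual-suc y (level b (y - c)))
                      (subst (λ l → 1ℚ - c ℚ.< (y - c) - fromℕ l * c) (sym l≡0)
                        (subst (1ℚ - c ℚ.<_) (sym (residual-zero (y - c))) (sub-monoˡ-< c (ℚ.≰⇒> y≰1)))))

  level-residual-nonneg : ∀ b y → 0ℚ ℚ.≤ 1ℚ - c → 0ℚ ℚ.≤ y → 0ℚ ℚ.≤ y - fromℕ (level b y) * c
  level-residual-nonneg b y 0≤1-c 0≤y with level-minimal b y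
  ... | inj₁ l≡0  = subst (λ l → 0ℚ ℚ.≤ y - fromℕ l * c) (sym l≡0)
                       (subst (0ℚ ℚ.≤_) (sym (residual-zero y)) 0≤y)
  ... | inj₂ 1-c<r = ℚ.<⇒≤ (ℚ.≤-<-trans 0≤1-c 1-c<r)

_-ᵖ_ : ∀ {d} → Point d → Point d → Point d
(x -ᵖ w) j = x j - w j

InUnitCube : ∀ {d} → Point d → Set
InUnitCube y = ∀ j → 0ℚ ℚ.≤ y j × y j ℚ.≤ 1ℚ

DescChain-cong : ∀ {d a} {y y′ : Point d} → (∀ i → y i ≡ y′ i) → DescChain a y → DescChain a y′
DescChain-cong {a = a} y≗y′ (top , step , bottom) =
  (λ i i≡0 → subst (ℚ._≤ a) (y≗y′ i) (top i i≡0)) ,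
  (λ i j j≡1+i → subst₂ ℚ._≤_ (y≗y′ j) (y≗y′ i) (step i j j≡1+i)) ,
  (λ i i-last → subst (0ℚ ℚ.≤_) (y≗y′ i) (bottom i i-last))

DescChain-antitone : ∀ {d a} {y : Point d} → DescChain a y → ∀ {i j} → i F.≤ j → y j ℚ.≤ y i
DescChain-antitone {suc d} {y = y} (_ , step , _) {i} =
  <-weakInduction-startingFrom (λ j → y j ℚ.≤ y i) ℚ.≤-refl
    (λ j yj≤yi → ℚ.≤-trans (step (inject₁ j) (suc j) (cong suc (sym (F.toℕ-inject₁ j)))) yj≤yi)

DescChain-≤ : ∀ {d a} {y : Point (suc d)} → DescChain a y → ∀ j → y j ℚ.≤ a
DescChain-≤ chain j = ℚ.≤-trans (DescChain-antitone chain {zero} {j} z≤n) (proj₁ chain zero refl)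

DescChain-nonneg : ∀ {d a} {y : Point (suc d)} → DescChain a y → ∀ j → 0ℚ ℚ.≤ y j
DescChain-nonneg {d} chain j =
  ℚ.≤-trans (proj₂ (proj₂ chain) (F.fromℕ d) (cong suc (F.toℕ-fromℕ d))) (DescChain-antitone chain (F.≤fromℕ j))

DescChain-translate : ∀ {d a} c {y : Point d} → DescChain a y → (∀ j → c ℚ.≤ y j) →
  DescChain (a - c) (λ j → y j - c)
DescChain-translate c (top , step , _) c≤y =
  (λ i i≡0 → sub-monoˡ-≤ c (top i i≡0)) ,
  (λ i j j≡1+i → sub-monoˡ-≤ c (step i j j≡1+i)) ,
  (λ i _ → p≤q⇒0≤q-p (c≤y i))

InUnitRightSimplex-cong : ∀ {d} {v v′ : Point d} {π π′ : Permutation′ d} {x} →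
  (∀ j → v j ≡ v′ j) → (∀ i → π ⟨$⟩ʳ i ≡ π′ ⟨$⟩ʳ i) →
  InUnitRightSimplex v π x → InUnitRightSimplex v′ π′ x
InUnitRightSimplex-cong {v = v} {π′ = π′} {x} v≗v′ π≗π′ = DescChain-cong λ i →
  trans (cong (λ j → x j - v j) (π≗π′ i)) (cong (λ q → x (π′ ⟨$⟩ʳ i) - q) (v≗v′ (π′ ⟨$⟩ʳ i)))

InUnitRightSimplex-translate : ∀ {d} c {v : Point d} {π x} →
  InUnitRightSimplex v π (λ j → x j - c) → InUnitRightSimplex (λ j → v j + c) π x
InUnitRightSimplex-translate c {v} {π} {x} = DescChain-cong λ i →
  solve 3 (λ x v c → (x :- c) :- v := x :- (v :+ c)) refl (x (π ⟨$⟩ʳ i)) (v (π ⟨$⟩ʳ i)) c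

-- A record, so that membership in two definitionally equal simplices is checked by comparing the
-- simplices rather than the unfolded rational arithmetic of their defining inequalities.
record InSimplex {d} (S : Point d × Permutation′ d) (x : Point d) : Set where
  constructor inSimplex
  field inUnitRightSimplex : InUnitRightSimplex (proj₁ S) (proj₂ S) x

Covers : ∀ {d N} → (Fin N → Point d × Permutation′ d) → (Point d → Set) → Set
Covers F X = ∀ x → X x → ∃ λ k → InSimplex (F k) x

Covers-++ : ∀ {d m k} {F : Fin m → Point d × Permutation′ d} {G : Fin k → Point d × Permutation′ d}
  {X Y Z : Point d → Set} → (∀ x → Z x → X x ⊎ Y x) → Covers F X → Covers G Y → Covers (F ++ G) Z
Covers-++ {m = m} {k} {F} {G} split F-covers G-covers x x∈Z with split x x∈Z
... | inj₁ x∈X = let i , x∈Fi = F-covers x x∈X in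
  i ↑ˡ k , subst (λ S → InSimplex S x) (sym (lookup-++ˡ F G i)) x∈Fi
... | inj₂ x∈Y = let i , x∈Gi = G-covers x x∈Y in
  m ↑ʳ i , subst (λ S → InSimplex S x) (sym (lookup-++ʳ F G i)) x∈Gi

Covers⇒CoveredBy : ∀ {d N a} {F : Fin N → Point d × Permutation′ d} → Covers F (InS a) → CoveredBy d N a
Covers⇒CoveredBy {F = F} F-covers = proj₁ ∘ F , proj₂ ∘ F , λ x x∈S →
  let k , x∈Fk = F-covers x x∈S in k , InSimplex.inUnitRightSimplex x∈Fk

module ℚSort = StableSort ℚ.≤-decTotalOrder
module ℕSort = StableSort ℕ.≤-decTotalOrder

InUnitCube⇒InUnitRightSimplex : ∀ {d} {x w : Point d} → InUnitCube (x -ᵖ w) →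
  InUnitRightSimplex w (ℚSort.sortBy (x -ᵖ w)) x
InUnitCube⇒InUnitRightSimplex {x = x} {w} cube =
  (λ i _ → proj₂ (cube (P ⟨$⟩ʳ i))) ,
  (λ i j j≡1+i → proj₁ (ℚSort.sortBy-sorted (x -ᵖ w) (ℕ.≤-reflexive (sym j≡1+i)))) ,
  (λ i _ → proj₁ (cube (P ⟨$⟩ʳ i)))
  where P = ℚSort.sortBy (x -ᵖ w)

Compatible : ∀ {d} → (Fin d → ℕ) → Point d → Set
Compatible g f = ∀ {j j′} → j F.< j′ → g j′ ℕ.≤ g j × (g j ≡ g j′ → f j′ ℚ.≤ f j)

Compatible-residual : ∀ {d} c (y : Point d) (g : Fin d → ℕ) {f : Point d} →
  (∀ {j j′} → j F.< j′ → y j′ ℚ.≤ y j) → (∀ {j j′} → j F.< j′ → g j′ ℕ.≤ g j) →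
  (∀ j → f j ≡ y j - fromℕ (g j) * c) → Compatible g f
Compatible-residual c y g {f} y↓ g↓ f≗ {j} {j′} j<j′ = g↓ j<j′ , λ gj≡gj′ →
  subst₂ ℚ._≤_ (sym (f≗ j′)) (sym (f≗ j))
    (subst (λ l → y j′ - fromℕ l * c ℚ.≤ y j - fromℕ (g j) * c) gj≡gj′ (sub-monoˡ-≤ _ (y↓ j<j′)))

sortBy-levels : ∀ {d} {g : Fin d → ℕ} {f : Point d} → Compatible g f →
  ∀ h → (∀ r → h r ≡ g (ℚSort.sortBy f ⟨$⟩ʳ r)) →
  ∀ j → ℕSort.sortBy h ⟨$⟩ʳ j ≡ ℚSort.sortBy f ⟨$⟩ˡ j
sortBy-levels {g = g} {f} compatible h h≗g∘P =
  ℕSort.sorted-unique h (ℕSort.sortBy h) (flip P) (ℕSort.sortBy-sorted h) P⁻¹-sorted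
  where
  P = ℚSort.sortBy f
  h∘P⁻¹ : ∀ j → h (P ⟨$⟩ˡ j) ≡ g j
  h∘P⁻¹ j = trans (h≗g∘P _) (cong g (inverseʳ P))
  P⁻¹-sorted : ℕSort.SortedBy h (flip P)
  P⁻¹-sorted {i} {j} i<j =
    subst₂ (λ hi hj → hj ℕ.≤ hi × (hi ℕ.≤ hj → P ⟨$⟩ˡ i F.< P ⟨$⟩ˡ j))
           (sym (h∘P⁻¹ i)) (sym (h∘P⁻¹ j))
      (proj₁ (compatible i<j) , rank<)
    where
    rank< : g i ℕ.≤ g j → P ⟨$⟩ˡ i F.< P ⟨$⟩ˡ j
    rank< gi≤gj = ℚSort.sorted-rank f P (ℚSort.sortBy-sorted f)
      (subst₂ (ℚSort.Precedes f) (sym (inverseʳ P)) (sym (inverseʳ P))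
        (proj₂ (compatible i<j) (ℕ.≤-antisym gi≤gj (proj₁ (compatible i<j))) , λ _ → i<j))

-- h r is the level of the coordinate ranked r, and T l q is the translation coordinate at level l
-- when q is the coordinate ranked first.
kuhnSimplex : ∀ {d} → (ℕ → Fin (suc d) → ℚ) → (Fin (suc d) → ℕ) → Point (suc d) × Permutation′ (suc d)
kuhnSimplex T h = (λ j → T (h (σ ⟨$⟩ʳ j)) (σ ⟨$⟩ˡ zero)) , flip σ
  where σ = ℕSort.sortBy h

∈-kuhnSimplex : ∀ {d N V} (T : ℕ → Fin (suc d) → ℚ) (enum : Fin N → Fin (suc d) → Fin V)
  {x w : Point (suc d)} {g : Fin (suc d) → ℕ} →
  InUnitCube (x -ᵖ w) → Compatible g (x -ᵖ w) →
  (∀ j → w j ≡ T (g j) (ℚSort.sortBy (x -ᵖ w) ⟨$⟩ʳ zero)) →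
  (∃ λ k → ∀ r → toℕ (enum k r) ≡ g (ℚSort.sortBy (x -ᵖ w) ⟨$⟩ʳ r)) →
  ∃ λ k → InSimplex (kuhnSimplex T (toℕ ∘ enum k)) x
∈-kuhnSimplex T enum {x} {w} {g} cube compatible w≗T (k , h≗g∘P) =
  k , inSimplex (InUnitRightSimplex-cong {π = P} {flip σ} {x} w≗v P≗σ⁻¹ (InUnitCube⇒InUnitRightSimplex {x = x} {w} cube))
  where
  h = toℕ ∘ enum k
  P = ℚSort.sortBy (x -ᵖ w)
  σ = ℕSort.sortBy h
  σ≗P⁻¹ = sortBy-levels compatible h h≗g∘P
  P≗σ⁻¹ : ∀ i → P ⟨$⟩ʳ i ≡ σ ⟨$⟩ˡ i
  P≗σ⁻¹ i = trans (sym (inverseˡ σ)) (cong (σ ⟨$⟩ˡ_) (trans (σ≗P⁻¹ (P ⟨$⟩ʳ i)) (inverseˡ P)))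
  w≗v : ∀ j → w j ≡ T (h (σ ⟨$⟩ʳ j)) (σ ⟨$⟩ˡ zero)
  w≗v j = trans (w≗T j)
    (cong₂ T (sym (trans (cong h (σ≗P⁻¹ j)) (trans (h≗g∘P _) (cong g (inverseʳ P))))) (P≗σ⁻¹ zero))

kuhnFamily : ∀ {d} m → Fin (suc m ^ suc d) → Point (suc d) × Permutation′ (suc d)
kuhnFamily m k = kuhnSimplex (λ l _ → fromℕ l) (toℕ ∘ finToFun k)

kuhnFamily-covers : ∀ {d} m → Covers (kuhnFamily {d} m) (InS (fromℕ (suc m)))
kuhnFamily-covers m x x∈S =
  ∈-kuhnSimplex (λ l _ → fromℕ l) finToFun {x} {w} {g} cube compatible (λ _ → refl)
    (funToFin u , λ r → trans (cong toℕ (F.finToFun-funToFin u r)) (F.toℕ-fromℕ< _))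
  where
  g = λ j → level 1ℚ m (x j)
  w = λ j → fromℕ (g j)
  residual : ∀ j → (x -ᵖ w) j ≡ x j - fromℕ (g j) * 1ℚ
  residual j = cong (λ q → x j - q) (sym (ℚ.*-identityʳ _))
  x-m≤1 : ∀ j → x j - fromℕ m * 1ℚ ℚ.≤ 1ℚ
  x-m≤1 j = subst (x j - fromℕ m * 1ℚ ℚ.≤_)
    (trans (cong (λ q → q - fromℕ m * 1ℚ) (fromℕ-suc m))
           (solve 1 (λ m → (con 1ℚ :+ m) :- m :* con 1ℚ := con 1ℚ) refl (fromℕ m)))
    (sub-monoˡ-≤ _ (DescChain-≤ x∈S j))
  cube : InUnitCube (x -ᵖ w)
  cube j = subst (λ q → 0ℚ ℚ.≤ q × q ℚ.≤ 1ℚ) (sym (residual j))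
    (level-residual-nonneg 1ℚ m (x j) (ℚ.≤-reflexive (sym (ℚ.+-inverseʳ 1ℚ))) (DescChain-nonneg x∈S j) ,
     level-reaches 1ℚ m (x j) (x-m≤1 j))
  compatible : Compatible g (x -ᵖ w)
  compatible = Compatible-residual 1ℚ x g (DescChain-antitone x∈S ∘ ℕ.<⇒≤)
    (level-mono 1ℚ m ∘ DescChain-antitone x∈S ∘ ℕ.<⇒≤) residual
  P = ℚSort.sortBy (x -ᵖ w)
  u : Fin _ → Fin (suc m)
  u r = F.fromℕ< (s≤s (level-≤ 1ℚ m (x (P ⟨$⟩ʳ r))))

-- Maps Fin d → Fin (suc K) taking the value zero: either the first value is zero and the rest is
-- arbitrary, or the first value is one of the K others and the rest takes the value zero.
#withZero : ℕ → ℕ → ℕ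
#withZero K zero    = 0
#withZero K (suc d) = suc K ^ d ℕ.+ K ℕ.* #withZero K d

withZero : ∀ K d → Fin (#withZero K d) → Fin d → Fin (suc K)
withZero K zero    = λ ()
withZero K (suc d) =
  (λ k → zero ∷ finToFun k) ++ (uncurry (λ q k → suc q ∷ withZero K d k) ∘ remQuot (#withZero K d))

withZero-surjective : ∀ K d (u : Fin d → Fin (suc K)) → (∃ λ i → u i ≡ zero) →
  ∃ λ k → ∀ j → withZero K d k j ≡ u j
withZero-surjective K zero u (() , _)
withZero-surjective K (suc d) u (i , ui≡0) with u zero in u0≡ | i
... | zero  | _ = funToFin (u ∘ suc) ↑ˡ _ , λ j →
  trans (cong-app (lookup-++ˡ _ _ (funToFin (u ∘ suc))) j) (tail j)
  where
  tail : ∀ j → (zero ∷ finToFun (funToFin (u ∘ suc))) j ≡ u j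
  tail zero    = sym u0≡
  tail (suc j) = F.finToFun-funToFin (u ∘ suc) j
... | suc q | zero   = contradiction (trans (sym u0≡) ui≡0) λ ()
... | suc q | suc i′ = suc K ^ d ↑ʳ combine q k , λ j →
  trans (cong-app (lookup-++ʳ (λ k → zero ∷ finToFun k) (cons ∘ remQuot (#withZero K d)) (combine q k)) j)
    (trans (cong (λ qk → cons qk j) (F.remQuot-combine q k)) (tail j))
  where
  cons = uncurry (λ q k → suc q ∷ withZero K d k)
  k = proj₁ (withZero-surjective K d (u ∘ suc) (i′ , ui≡0))
  tail : ∀ j → (suc q ∷ withZero K d k) j ≡ u j
  tail zero    = sym u0≡
  tail (suc j) = proj₂ (withZero-surjective K d (u ∘ suc) (i′ , ui≡0)) j

#withZero+K^d≡[1+K]^d : ∀ K d → #withZero K d ℕ.+ K ^ d ≡ suc K ^ d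
#withZero+K^d≡[1+K]^d K zero    = refl
#withZero+K^d≡[1+K]^d K (suc d) = begin
  (suc K ^ d ℕ.+ K ℕ.* #withZero K d) ℕ.+ K ℕ.* K ^ d
    ≡⟨ ℕ.+-assoc (suc K ^ d) _ _ ⟩
  suc K ^ d ℕ.+ (K ℕ.* #withZero K d ℕ.+ K ℕ.* K ^ d)
    ≡⟨ cong (suc K ^ d ℕ.+_) (sym (ℕ.*-distribˡ-+ K _ _)) ⟩
  suc K ^ d ℕ.+ K ℕ.* (#withZero K d ℕ.+ K ^ d)
    ≡⟨ cong (λ m → suc K ^ d ℕ.+ K ℕ.* m) (#withZero+K^d≡[1+K]^d K d) ⟩
  suc K ^ d ℕ.+ K ℕ.* suc K ^ d
    ∎
  where open ≡-Reasoning

module BottomLayer (d′ n : ℕ) (ε : ℚ) (0<ε : 0ℚ ℚ.< ε) ([n+1]ε≤1 : fromℕ (suc n) * ε ℚ.≤ 1ℚ) where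

  d : ℕ
  d = suc (suc d′)

  a : ℚ
  a = fromℕ n + ε

  last : Fin d
  last = F.fromℕ (suc d′)

  s : ℚ
  s = 1ℚ - ε

  1-s≡ε : 1ℚ - s ≡ ε
  1-s≡ε = solve 1 (λ e → con 1ℚ :- (con 1ℚ :- e) := e) refl ε

  a-ns≤1 : a - fromℕ n * s ℚ.≤ 1ℚ
  a-ns≤1 = subst (ℚ._≤ 1ℚ) (sym a-ns≡[n+1]ε) [n+1]ε≤1
    where
    a-ns≡[n+1]ε : a - fromℕ n * s ≡ fromℕ (suc n) * ε
    a-ns≡[n+1]ε = trans (solve 2 (λ m e → (m :+ e) :- m :* (con 1ℚ :- e) := (con 1ℚ :+ m) :* e) refl (fromℕ n) ε)
                        (cong (_* ε) (sym (fromℕ-suc n)))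

  last-or-other : ∀ {ℓ} {P : Fin d → Set ℓ} → P last → (∀ {j} → j ≢ last → P j) → ∀ j → P j
  last-or-other p-last p-other j with j F.≟ last
  ... | yes refl   = p-last
  ... | no  j≢last = p-other j≢last

  -- shift and g are opaque: the conversion checker would otherwise evaluate them on indices
  -- produced by sorting rationals.
  opaque
    shift : Fin d → ℚ
    shift q with q F.≟ last
    ... | yes _ = ε
    ... | no  _ = 0ℚ

    shift-last : shift last ≡ ε
    shift-last with last F.≟ last
    ... | yes _         = refl
    ... | no  last≢last = contradiction refl last≢last

    shift-other : ∀ {q} → q ≢ last → shift q ≡ 0ℚ
    shift-other {q} q≢last with q F.≟ last
    ... | yes q≡last = contradiction q≡last q≢last
    ... | no  _      = refl

  bottomFamily : Fin (#withZero n d) → Point d × Permutation′ d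
  bottomFamily k = kuhnSimplex (λ l q → fromℕ l * s + shift q) (toℕ ∘ withZero n d k)

  module _ {x : Point d} (x∈S : InS a x) (xlast≤1+ε : x last ℚ.≤ 1ℚ + ε) where

    t : ℚ
    t = x last

    x↓ : ∀ {i j} → i F.≤ j → x j ℚ.≤ x i
    x↓ = DescChain-antitone x∈S

    opaque
      g : Fin d → ℕ
      g j with j F.≟ last
      ... | yes _ = 0
      ... | no  _ = level s n (x j)

      g-last : g last ≡ 0
      g-last with last F.≟ last
      ... | yes _         = refl
      ... | no  last≢last = contradiction refl last≢last

      g-other : ∀ {j} → j ≢ last → g j ≡ level s n (x j)
      g-other {j} j≢last with j F.≟ last
      ... | yes j≡last = contradiction j≡last j≢last
      ... | no  _      = refl

    g≤n : ∀ j → g j ℕ.≤ n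
    g≤n = last-or-other (subst (ℕ._≤ n) (sym g-last) z≤n)
                        (λ {j} j≢last → subst (ℕ._≤ n) (sym (g-other j≢last)) (level-≤ s n (x j)))

    g↓ : ∀ {j j′} → j F.< j′ → g j′ ℕ.≤ g j
    g↓ {j} {j′} j<j′ = last-or-other {P = λ j′ → j F.< j′ → g j′ ℕ.≤ g j}
      (λ _ → subst (ℕ._≤ g j) (sym g-last) z≤n)
      (λ j′≢last j<j′ → subst₂ ℕ._≤_ (sym (g-other j′≢last)) (sym (g-other (j≢last j<j′)))
                          (level-mono s n (x↓ (ℕ.<⇒≤ j<j′))))
      j′ j<j′
      where
      j≢last : ∀ {j′} → j F.< j′ → j ≢ last
      j≢last {j′} j<j′ refl = ℕ.<⇒≱ j<j′ (F.≤fromℕ j′)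

    r : Fin d → ℚ
    r j = x j - fromℕ (g j) * s

    r-other : ∀ {j} → j ≢ last → r j ≡ x j - fromℕ (level s n (x j)) * s
    r-other {j} j≢last = cong (λ l → x j - fromℕ l * s) (g-other j≢last)

    r-level0 : ∀ {j} → g j ≡ 0 → r j ≡ x j
    r-level0 {j} gj≡0 = trans (cong (λ l → x j - fromℕ l * s) gj≡0) (residual-zero s (x j))

    r-last : r last ≡ t
    r-last = r-level0 g-last

    r≤1 : ∀ {j} → j ≢ last → r j ℚ.≤ 1ℚ
    r≤1 {j} j≢last = subst (ℚ._≤ 1ℚ) (sym (r-other j≢last))
      (level-reaches s n (x j) (ℚ.≤-trans (sub-monoˡ-≤ (fromℕ n * s) (DescChain-≤ x∈S j)) a-ns≤1))

    r-nonneg : ∀ j → 0ℚ ℚ.≤ r j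
    r-nonneg = last-or-other (subst (0ℚ ℚ.≤_) (sym r-last) (DescChain-nonneg x∈S last)) λ {j} j≢last →
      subst (0ℚ ℚ.≤_) (sym (r-other j≢last))
        (level-residual-nonneg s n (x j) (subst (0ℚ ℚ.≤_) (sym 1-s≡ε) (ℚ.<⇒≤ 0<ε)) (DescChain-nonneg x∈S j))

    -- a coordinate of level 0 has residual x j ≥ t
    ε<r : ∀ {j} → j ≢ last → r j ℚ.< t → ε ℚ.< r j
    ε<r {j} j≢last rj<t with level-minimal s n (x j)
    ... | inj₂ 1-s<r = subst₂ ℚ._<_ 1-s≡ε (sym (r-other j≢last)) 1-s<r
    ... | inj₁ l≡0   = contradiction
      (subst (t ℚ.≤_) (sym (r-level0 (trans (g-other j≢last) l≡0))) (x↓ (F.≤fromℕ j))) (<⇒≱ rj<t)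

    w : ℚ → Point d
    w sh j = fromℕ (g j) * s + sh

    residual-shift : ∀ sh j → (x -ᵖ w sh) j ≡ r j - sh
    residual-shift sh j = solve 3 (λ x l sh → x :- (l :+ sh) := (x :- l) :- sh) refl (x j) (fromℕ (g j) * s) sh

    covered-with-shift : ∀ sh → InUnitCube (x -ᵖ w sh) →
      shift (ℚSort.sortBy (x -ᵖ w sh) ⟨$⟩ʳ zero) ≡ sh → ∃ λ k → InSimplex (bottomFamily k) x
    covered-with-shift sh cube shift≡sh =
      ∈-kuhnSimplex (λ l q → fromℕ l * s + shift q) (withZero n d) {x} {w sh} {g} cube compatible
        (λ j → cong (λ q → fromℕ (g j) * s + q) (sym shift≡sh)) (k , h≗g∘P)
      where
      compatible : Compatible g (x -ᵖ w sh)
      compatible = Compatible-residual s (λ j → x j - sh) g (sub-monoˡ-≤ sh ∘ x↓ ∘ ℕ.<⇒≤) g↓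
        (λ j → solve 3 (λ x l sh → x :- (l :+ sh) := (x :- sh) :- l) refl (x j) (fromℕ (g j) * s) sh)
      u : Fin d → Fin (suc n)
      u r = F.fromℕ< (s≤s (g≤n (ℚSort.sortBy (x -ᵖ w sh) ⟨$⟩ʳ r)))
      u-hits-zero : u (ℚSort.sortBy (x -ᵖ w sh) ⟨$⟩ˡ last) ≡ zero
      u-hits-zero = F.toℕ-injective
        (trans (F.toℕ-fromℕ< _) (trans (cong g (inverseʳ (ℚSort.sortBy (x -ᵖ w sh)))) g-last))
      k,enum≗u = withZero-surjective n d u (ℚSort.sortBy (x -ᵖ w sh) ⟨$⟩ˡ last , u-hits-zero)
      k = proj₁ k,enum≗u
      h≗g∘P : ∀ r → toℕ (withZero n d k r) ≡ g (ℚSort.sortBy (x -ᵖ w sh) ⟨$⟩ʳ r)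
      h≗g∘P r = trans (cong toℕ (proj₂ k,enum≗u r)) (F.toℕ-fromℕ< _)

    unshifted : ∀ j₀ → j₀ ≢ last → t ℚ.≤ r j₀ → ∃ λ k → InSimplex (bottomFamily k) x
    unshifted j₀ j₀≢last t≤rj₀ = covered-with-shift 0ℚ cube (shift-other
      (ℚSort.sorted-head-not (x -ᵖ w 0ℚ) (ℚSort.sortBy (x -ᵖ w 0ℚ)) (ℚSort.sortBy-sorted (x -ᵖ w 0ℚ)) j₀≺last))
      where
      residual≡r : ∀ j → (x -ᵖ w 0ℚ) j ≡ r j
      residual≡r j = trans (residual-shift 0ℚ j) (ℚ.+-identityʳ (r j))
      r≤1′ : ∀ j → r j ℚ.≤ 1ℚ
      r≤1′ = last-or-other (subst (ℚ._≤ 1ℚ) (sym r-last) (ℚ.≤-trans t≤rj₀ (r≤1 j₀≢last))) r≤1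
      cube : InUnitCube (x -ᵖ w 0ℚ)
      cube j = subst (λ q → 0ℚ ℚ.≤ q × q ℚ.≤ 1ℚ) (sym (residual≡r j)) (r-nonneg j , r≤1′ j)
      j₀≺last : ℚSort.Precedes (x -ᵖ w 0ℚ) j₀ last
      j₀≺last = subst₂ ℚ._≤_ (sym (trans (residual≡r last) r-last)) (sym (residual≡r j₀)) t≤rj₀ ,
                λ _ → F.≤∧≢⇒< (F.≤fromℕ j₀) j₀≢last

    shifted : (∀ j → j ≢ last → r j ℚ.< t) → ∃ λ k → InSimplex (bottomFamily k) x
    shifted r<t = covered-with-shift ε cube (trans (cong shift
      (ℚSort.sorted-head (x -ᵖ w ε) (ℚSort.sortBy (x -ᵖ w ε)) (ℚSort.sortBy-sorted (x -ᵖ w ε)) last≺)) shift-last)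
      where
      residual-last : (x -ᵖ w ε) last ≡ t - ε
      residual-last = trans (residual-shift ε last) (cong (_- ε) r-last)
      ε≤t : ε ℚ.≤ t
      ε≤t = ℚ.<⇒≤ (ℚ.<-trans (ε<r {zero} (λ ()) (r<t zero λ ())) (r<t zero λ ()))
      t-ε≤1 : t - ε ℚ.≤ 1ℚ
      t-ε≤1 = subst (t - ε ℚ.≤_) (solve 1 (λ e → (con 1ℚ :+ e) :- e := con 1ℚ) refl ε) (sub-monoˡ-≤ ε xlast≤1+ε)
      cube : InUnitCube (x -ᵖ w ε)
      cube = last-or-other (subst (λ q → 0ℚ ℚ.≤ q × q ℚ.≤ 1ℚ) (sym residual-last) (p≤q⇒0≤q-p ε≤t , t-ε≤1))
        λ {j} j≢last → subst (λ q → 0ℚ ℚ.≤ q × q ℚ.≤ 1ℚ) (sym (residual-shift ε j))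
          (p≤q⇒0≤q-p (ℚ.<⇒≤ (ε<r j≢last (r<t j j≢last))) ,
           ℚ.≤-trans (0≤r⇒p-r≤p (r j) (ℚ.<⇒≤ 0<ε)) (r≤1 j≢last))
      last≺ : ∀ j → j ≢ last → ℚSort.Precedes (x -ᵖ w ε) last j
      last≺ j j≢last = ℚ.<⇒≤ residual<residual-last , λ last≤j → contradiction last≤j (<⇒≱ residual<residual-last)
        where
        residual<residual-last : (x -ᵖ w ε) j ℚ.< (x -ᵖ w ε) last
        residual<residual-last = subst₂ ℚ._<_ (sym (residual-shift ε j)) (sym residual-last)
          (sub-monoˡ-< ε (r<t j j≢last))

    covered : ∃ λ k → InSimplex (bottomFamily k) x
    covered = by-cases (F.any? λ j → ¬? (j F.≟ last) ×-dec (t ℚ.≤? r j))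
      where
      by-cases : Dec (∃ λ j → j ≢ last × t ℚ.≤ r j) → ∃ λ k → InSimplex (bottomFamily k) x
      by-cases (yes (j , j≢last , t≤rj)) = unshifted j j≢last t≤rj
      by-cases (no ∄) = shifted λ j j≢last → ℚ.≰⇒> λ t≤rj → ∄ (j , j≢last , t≤rj)

  bottomFamily-covers : Covers bottomFamily (λ x → InS a x × x last ℚ.≤ 1ℚ + ε)
  bottomFamily-covers x (x∈S , xlast≤1+ε) = covered {x} x∈S xlast≤1+ε

translate : ∀ {d} → ℚ → Point d × Permutation′ d → Point d × Permutation′ d
translate c (v , π) = (λ j → v j + c) , π

topFamily : ∀ d′ p → ℚ → Fin (p ^ suc (suc d′)) → Point (suc (suc d′)) × Permutation′ (suc (suc d′))
topFamily d′ zero    ε ()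
topFamily d′ (suc m) ε k = translate (1ℚ + ε) (kuhnFamily m k)

topFamily-covers : ∀ d′ p ε → Covers (topFamily d′ p ε)
  (λ x → InS (fromℕ (suc p) + ε) x × 1ℚ + ε ℚ.< x (F.fromℕ (suc d′)))
topFamily-covers d′ zero    ε x (x∈S , 1+ε<xlast) =
  contradiction (DescChain-≤ x∈S (F.fromℕ (suc d′))) (<⇒≱ 1+ε<xlast)
topFamily-covers d′ (suc m) ε x (x∈S , 1+ε<xlast) =
  let k , inSimplex x-c∈ = kuhnFamily-covers m (λ j → x j - c) x-c∈S in
  k , inSimplex (InUnitRightSimplex-translate c {proj₁ (kuhnFamily m k)} {proj₂ (kuhnFamily m k)} {x} x-c∈)
  where
  c = 1ℚ + ε
  a-c≡m+1 : (fromℕ (suc (suc m)) + ε) - c ≡ fromℕ (suc m)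
  a-c≡m+1 = trans (cong (λ q → (q + ε) - c) (fromℕ-suc (suc m)))
    (solve 2 (λ m e → ((con 1ℚ :+ m) :+ e) :- (con 1ℚ :+ e) := m) refl (fromℕ (suc m)) ε)
  x-c∈S : InS (fromℕ (suc m)) (λ j → x j - c)
  x-c∈S = subst (λ b → DescChain b (λ j → x j - c)) a-c≡m+1
    (DescChain-translate {a = fromℕ (suc (suc m)) + ε} c {x} x∈S λ j →
      ℚ.<⇒≤ (ℚ.<-≤-trans 1+ε<xlast (DescChain-antitone x∈S (F.≤fromℕ j))))

coverSize : ∀ d p → ((suc p ℕ.+ 1) ^ d ℕ.+ p ^ d) ℕ.∸ suc p ^ d ≡ #withZero (suc p) d ℕ.+ p ^ d
coverSize d p = begin
  ((suc p ℕ.+ 1) ^ d ℕ.+ p ^ d) ℕ.∸ suc p ^ d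
    ≡⟨ cong (λ m → (m ^ d ℕ.+ p ^ d) ℕ.∸ suc p ^ d) (ℕ.+-comm (suc p) 1) ⟩
  (suc (suc p) ^ d ℕ.+ p ^ d) ℕ.∸ suc p ^ d
    ≡⟨ cong (λ m → (m ℕ.+ p ^ d) ℕ.∸ suc p ^ d) (sym (#withZero+K^d≡[1+K]^d (suc p) d)) ⟩
  ((Z ℕ.+ suc p ^ d) ℕ.+ p ^ d) ℕ.∸ suc p ^ d
    ≡⟨ cong (ℕ._∸ suc p ^ d) (xy∙z≈xz∙y Z (suc p ^ d) (p ^ d)) ⟩
  ((Z ℕ.+ p ^ d) ℕ.+ suc p ^ d) ℕ.∸ suc p ^ d
    ≡⟨ ℕ.m+n∸n≡m (Z ℕ.+ p ^ d) (suc p ^ d) ⟩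
  Z ℕ.+ p ^ d
    ∎
  where
  open ≡-Reasoning
  Z = #withZero (suc p) d

mainTheorem1 : (d n : ℕ) → 2 ℕ.≤ d → 1 ℕ.≤ n →
    CoveredBy d (((n ℕ.+ 1) ^ d ℕ.+ (n ℕ.∸ 1) ^ d) ℕ.∸ n ^ d) (+ n ℚ./ 1 ℚ.+ δ n)
mainTheorem1 (suc (suc d′)) (suc p) (s≤s (s≤s z≤n)) (s≤s z≤n) =
  subst (λ N → CoveredBy (suc (suc d′)) N (fromℕ (suc p) + δ (suc p))) (sym (coverSize (suc (suc d′)) p))
    (Covers⇒CoveredBy {F = bottom ++ top} (Covers-++ {F = bottom} {top} split
      (BottomLayer.bottomFamily-covers d′ (suc p) (δ (suc p)) (δ-positive (suc p)) ([n+1]δ≤1 (suc p)))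
      (topFamily-covers d′ p (δ (suc p)))))
  where
  bottom = BottomLayer.bottomFamily d′ (suc p) (δ (suc p)) (δ-positive (suc p)) ([n+1]δ≤1 (suc p))
  top = topFamily d′ p (δ (suc p))
  split : ∀ x → InS (fromℕ (suc p) + δ (suc p)) x →
    (InS (fromℕ (suc p) + δ (suc p)) x × x (F.fromℕ (suc d′)) ℚ.≤ 1ℚ + δ (suc p)) ⊎
    (InS (fromℕ (suc p) + δ (suc p)) x × 1ℚ + δ (suc p) ℚ.< x (F.fromℕ (suc d′)))
  split x x∈S with x (F.fromℕ (suc d′)) ℚ.≤? 1ℚ + δ (suc p)
  ... | yes xlast≤1+δ = inj₁ (x∈S , xlast≤1+δ)
  ... | no  xlast≰1+δ = inj₂ (x∈S , ℚ.≰⇒> xlast≰1+δ)
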